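{- Let $(H,k,\chi)$ be an instance of Precoloring Extension where $H$ has at least one edge, and consider the $P_n\,|\,\mathrm{conc}\,|\,C_{\max}$ instance constructed from it as described in the context. If there is a feasible schedule $C$ for the constructed instance with $C_{\max}\le k$, then there is a solution $\chi':\{1,\ldots,n\}\to\{1,\ldots,k\}$ to $(H,k,\chi)$.
   Context: Precoloring Extension: given a graph $H=(V,F)$ with $V=\{1,\ldots,n\}$, an integer $k$, and a proper coloring $\chi:V_0\to\{1,\ldots,k\}$ of $H[V_0]$ for some $V_0\subseteq V$; a solution is a proper coloring $\chi':V\to\{1,\ldots,k\}$ of $H$ with $\chi'(v)=\chi(v)$ for all $v\in V_0$. Scheduling: jobs with positive integer processing times $p_j$, all release times $0$, conflict graph $G$; a schedule $C$ (completion times in $\mathbb{N}$) is feasible if $C_j-p_j\ge0$ for all jobs and $[C_i-p_i,C_i)\cap[C_j-p_j,C_j)=\emptyset$ for every edge $\{i,j\}$ of $G$; $C_{\max}=\max_jC_j$. Construction: start with $G=H$, with $p_j=1$ for each $j\in V$. Add jobs $a,a',b,b'$ with $p_a=p_b=1$, $p_{a'}=p_{b'}=k-1$, and edges $\{a,a'\},\{b,b'\},\{a,b\}$. For each $j\in V_0$ with $\chi(j)\in\{2,\ldots,k-1\}$, add jobs $j(1),j(2)$ with $p_{j(1)}=\chi(j)-1$, $p_{j(2)}=k-\chi(j)$, and edges $\{j,j(1)\},\{j,j(2)\},\{j(1),j(2)\},\{a,j\},\{b,j\},\{a,j(2)\},\{b,j(1)\}$. For $j\in V_0$ with $\chi(j)=1$,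 add only $j(2)$ (with $p_{j(2)}=k-1$) and edges $\{j,j(2)\},\{b,j\},\{a,j(2)\}$. For $j\in V_0$ with $\chi(j)=k$, add only $j(1)$ (with $p_{j(1)}=k-1$) and edges $\{j,j(1)\},\{a,j\},\{b,j(1)\}$. -}

module Defs where

open import Data.Nat using (ℕ; _≤_; _<_; _∸_)
open import Data.Fin using (Fin)
open import Data.Maybe using (Maybe; just; nothing)
open import Data.Product using (_×_; Σ; ∃)
open import Data.Sum using (_⊎_)
open import Data.Empty using (⊥)
open import Data.Unit using (⊤)
open import Relation.Nullary using (¬_)
open import Relation.Binary.PropositionalEquality using (_≡_; _≢_)

record Graph (n : ℕ) : Set₁ where
  field
    Adj    : Fin n → Fin n → Set
    sym    : ∀ {u v} → Adj u v → Adj v u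
    irrefl : ∀ {u} → ¬ Adj u u

-- An instance (H, k, χ) of Precoloring Extension.
-- Colours are natural numbers in {1,…,k}.
-- The precoloured set V₀ is {v | pre v ≡ just c for some c}, and χ(v) = c.
record PrecolInstance (n : ℕ) : Set₁ where
  field
    H          : Graph n
    k          : ℕ
    pre        : Fin n → Maybe ℕ
    pre-range  : ∀ v c → pre v ≡ just c → (1 ≤ c × c ≤ k)
    pre-proper : ∀ u v c d → Graph.Adj H u v → pre u ≡ just c → pre v ≡ just d → c ≢ d

open PrecolInstance

IsSolution : ∀ {n} → PrecolInstance n → (Fin n → ℕ) → Set
IsSolution I χ' =
  (∀ v → (1 ≤ χ' v × χ' v ≤ k I)) ×
  (∀ u v → Graph.Adj (H I) u v → χ' u ≢ χ' v) ×
  (∀ v c → pre I v ≡ just c → χ' v ≡ c)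

-- Candidate jobs of the constructed scheduling instance.
-- vtx j : the job j ∈ V;  a, a', b, b' : the four extra jobs;
-- j1 j, j2 j : the jobs j(1), j(2) (only present when required, see Present).
data Job (n : ℕ) : Set where
  vtx       : Fin n → Job n
  a a' b b' : Job n
  j1 j2     : Fin n → Job n

HasJ1 : Maybe ℕ → Set
HasJ1 nothing  = ⊥
HasJ1 (just c) = c ≢ 1

HasJ2 : ℕ → Maybe ℕ → Set
HasJ2 k nothing  = ⊥
HasJ2 k (just c) = c ≢ k

Present : ∀ {n} → PrecolInstance n → Job n → Set
Present I (vtx _) = ⊤
Present I a       = ⊤
Present I a'      = ⊤
Present I b       = ⊤
Present I b'      = ⊤
Present I (j1 j)  = HasJ1 (pre I j)
Present I (j2 j)  = HasJ2 (k I) (pre I j)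

p1 : Maybe ℕ → ℕ
p1 nothing  = 0
p1 (just c) = c ∸ 1

p2 : ℕ → Maybe ℕ → ℕ
p2 k nothing  = 0
p2 k (just c) = k ∸ c

ptime : ∀ {n} → PrecolInstance n → Job n → ℕ
ptime I (vtx _) = 1
ptime I a       = 1
ptime I b       = 1
ptime I a'      = k I ∸ 1
ptime I b'      = k I ∸ 1
ptime I (j1 j)  = p1 (pre I j)
ptime I (j2 j)  = p2 (k I) (pre I j)

-- Edges of the conflict graph G, each listed in one orientation.
Edge : ∀ {n} → PrecolInstance n → Job n → Job n → Set
Edge I (vtx u) (vtx v) = Graph.Adj (H I) u v
Edge I a a'            = ⊤
Edge I b b'            = ⊤
Edge I a b             = ⊤
Edge I (vtx j) (j1 j') = j ≡ j'
Edge I (vtx j) (j2 j') = j ≡ j'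
Edge I (j1 j) (j2 j')  = j ≡ j'
Edge I a (vtx j)       = HasJ1 (pre I j)
Edge I b (vtx j)       = HasJ2 (k I) (pre I j)
Edge I a (j2 j)        = ⊤
Edge I b (j1 j)        = ⊤
Edge I _ _             = ⊥

Conflict : ∀ {n} → PrecolInstance n → Job n → Job n → Set
Conflict I i j = Edge I i j ⊎ Edge I j i

InRun : ∀ {n} → PrecolInstance n → (Job n → ℕ) → Job n → ℕ → Set
InRun I C i t = (C i ∸ ptime I i ≤ t) × (t < C i)

-- Disjointness of [C_i-p_i,C_i) and [C_j-p_j,C_j) is expressed pointwise on
-- integer times, equivalent since all endpoints are integers.
Feasible : ∀ {n} → PrecolInstance n → (Job n → ℕ) → Set
Feasible I C =
  (∀ i → Present I i → ptime I i ≤ C i) ×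
  (∀ i j → Present I i → Present I j → Conflict I i j →
     ∀ t → ¬ (InRun I C i t × InRun I C j t))

CmaxLe : ∀ {n} → PrecolInstance n → (Job n → ℕ) → ℕ → Set
CmaxLe I C T = ∀ i → Present I i → C i ≤ T

module Submission where

-- Two adjacent vertices are unit jobs that must run at different times before k, so k ≥ 2
-- and every job of the instance has positive length; a feasible schedule is then a family
-- of pairwise ordered intervals in [0, k). The unit job a and the job a' of length k − 1
-- tile [0, k), so a starts at 0 or at k − 1, and likewise b; since a and b conflict, one
-- starts at 0 and the other at k − 1, and after reversing time a starts at 0. Colouring a
-- vertex by its start time plus one is then a proper k-colouring, and for a precoloured
-- vertex v of colour c the jobs j(1), v, j(2), squeezed between a and b, tile [0, k) in
-- this order, so v starts at c − 1.

open import Defs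
open import Data.Fin using (Fin)
open import Data.Maybe using (just)
open import Data.Nat using (ℕ; suc; _+_; _∸_; _≤_; _<_; z≤n; s≤s; _≤?_; _≟_)
open import Data.Nat.Properties
open import Data.Nat.Tactic.RingSolver using (solve-∀)
open import Data.Product using (Σ; _×_; _,_; proj₁; proj₂)
open import Data.Sum using (_⊎_; inj₁; inj₂; [_,_]′; map₂)
open import Data.Unit using (tt)
open import Data.Empty using (⊥-elim)
open import Function using (_∘_)
open import Relation.Nullary using (¬_; yes; no)
open import Relation.Binary.PropositionalEquality

record Interval : Set where
  constructor _,+_
  field
    start len : ℕ

  end : ℕ
  end = start + len

open Interval

infix 4 _≺_

_≺_ : Interval → Interval → Set
x ≺ y = end x ≤ start y

Apart : Interval → Interval → Set
Apart x y = x ≺ y ⊎ y ≺ x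

Occupies : Interval → ℕ → Set
Occupies x t = start x ≤ t × t < end x

len≤end : ∀ x → len x ≤ end x
len≤end x = m≤n+m (len x) (start x)

start<end : ∀ x → 0 < len x → start x < end x
start<end x = m<m+n (start x)

-- The later of the two start times would be occupied by both intervals.
disjoint⇒apart : ∀ {x y} → 0 < len x → 0 < len y →
  (∀ t → ¬ (Occupies x t × Occupies y t)) → Apart x y
disjoint⇒apart {x} {y} 0<x 0<y disjoint
  with end x ≤? start y | end y ≤? start x | ≤-total (start x) (start y)
... | yes x≺y | _       | _         = inj₁ x≺y
... | _       | yes y≺x | _         = inj₂ y≺x
... | no x⊀y  | _       | inj₁ sx≤sy =
  ⊥-elim (disjoint (start y) ((sx≤sy , ≰⇒> x⊀y) , (≤-refl , start<end y 0<y)))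
... | _       | no y⊀x  | inj₂ sy≤sx =
  ⊥-elim (disjoint (start x) ((≤-refl , start<end x 0<x) , (sy≤sx , ≰⇒> y⊀x)))

apart⇒start≢ : ∀ {x y} → Apart x y → 0 < len x → 0 < len y → start x ≢ start y
apart⇒start≢ {x} (inj₁ x≺y) 0<x _ sx≡sy =
  <⇒≱ (start<end x 0<x) (subst (end x ≤_) (sym sx≡sy) x≺y)
apart⇒start≢ {y = y} (inj₂ y≺x) _ 0<y sx≡sy =
  <⇒≱ (start<end y 0<y) (subst (end y ≤_) sx≡sy y≺x)

apart∧start≤⇒≺ : ∀ {x y} → Apart x y → start x ≤ start y → 0 < len y → x ≺ y
apart∧start≤⇒≺ (inj₁ x≺y) _ _ = x≺y
apart∧start≤⇒≺ {y = y} (inj₂ y≺x) sx≤sy 0<y =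
  ⊥-elim (<⇒≱ (start<end y 0<y) (≤-trans y≺x sx≤sy))

apart∧end≤⇒≺ : ∀ {x y} → Apart x y → end x ≤ end y → 0 < len x → x ≺ y
apart∧end≤⇒≺ (inj₁ x≺y) _ _ = x≺y
apart∧end≤⇒≺ {x} (inj₂ y≺x) ex≤ey 0<x =
  ⊥-elim (<⇒≱ (start<end x 0<x) (≤-trans ex≤ey y≺x))

≺-packing : ∀ {x y L U} → x ≺ y → L ≤ start x → end y ≤ U → L + (len x + len y) ≤ U
≺-packing {x} {y} {L} {U} x≺y L≤x y≤U = begin
  L + (len x + len y)  ≡⟨ +-assoc L (len x) (len y) ⟨
  L + len x + len y    ≤⟨ +-monoˡ-≤ (len y) (+-monoˡ-≤ (len x) L≤x) ⟩
  end x + len y        ≤⟨ +-monoˡ-≤ (len y) x≺y ⟩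
  end y                ≤⟨ y≤U ⟩
  U                    ∎
  where open ≤-Reasoning

apart-packing : ∀ {x y L U} → Apart x y → L ≤ start x → L ≤ start y → end x ≤ U → end y ≤ U →
  L + (len x + len y) ≤ U
apart-packing (inj₁ x≺y) L≤x _ _ y≤U = ≺-packing x≺y L≤x y≤U
apart-packing {x} {y} {L} {U} (inj₂ y≺x) _ L≤y x≤U _ =
  subst (λ m → L + m ≤ U) (+-comm (len y) (len x)) (≺-packing y≺x L≤y x≤U)

apart-tiling : ∀ {x y T} → Apart x y → len x + len y ≡ T → end x ≤ T → end y ≤ T →
  start x ≡ 0 ⊎ start x ≡ len y
apart-tiling {x} {y} (inj₁ x≺y) refl _ y≤T =
  inj₁ (n≤0⇒n≡0 (+-cancelʳ-≤ (len x + len y) (start x) 0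
                   (≺-packing {L = start x} x≺y ≤-refl y≤T)))
apart-tiling {x} {y} (inj₂ y≺x) refl x≤T _ =
  inj₂ (≤-antisym (+-cancelʳ-≤ (len x) (start x) (len y)
                     (subst (end x ≤_) (+-comm (len x) (len y)) x≤T))
                  (≤-trans (len≤end y) y≺x))

-- The three intervals tile [0, T); as y is neither first nor last and x is not last,
-- they come in the order x, y, z.
apart-middle : ∀ {x y z T} → Apart x y → Apart y z → Apart x z → len x + len y + len z ≡ T →
  0 < start y → end y < T → end x < T → end z ≤ T → start y ≡ len x
apart-middle {x} {y} {z} (inj₁ x≺y) (inj₁ y≺z) _ refl _ y<T _ z≤T =
  ≤-antisym (+-cancelʳ-≤ (len y + len z) (start y) (len x)
              (subst (start y + (len y + len z) ≤_) (+-assoc (len x) (len y) (len z))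
                     (≺-packing {L = start y} y≺z ≤-refl z≤T)))
            (≤-trans (len≤end x) x≺y)
apart-middle {x} {y} {z} (inj₁ x≺y) (inj₂ z≺y) x∥z refl _ y<T _ _ = ⊥-elim (<⇒≱ y<T (begin
  len x + len y + len z  ≡⟨ swap₂₃ (len x) (len y) (len z) ⟩
  len x + len z + len y  ≤⟨ +-monoˡ-≤ (len y) (apart-packing x∥z z≤n z≤n x≺y z≺y) ⟩
  end y                  ∎))
  where open ≤-Reasoning
        swap₂₃ : ∀ a b c → a + b + c ≡ a + c + b
        swap₂₃ = solve-∀
apart-middle {x} {y} {z} (inj₂ y≺x) (inj₁ y≺z) x∥z refl 0<y _ x<T z≤T =
  ⊥-elim (<-irrefl refl (begin-strict
  len x + len y + len z    ≡⟨ rotate (len x) (len y) (len z) ⟩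
  len y + (len x + len z)  <⟨ +-monoˡ-< (len x + len z) (m<n+m (len y) 0<y) ⟩
  end y + (len x + len z)  ≤⟨ apart-packing x∥z y≺x y≺z (<⇒≤ x<T) z≤T ⟩
  len x + len y + len z    ∎))
  where open ≤-Reasoning
        rotate : ∀ a b c → a + b + c ≡ b + (a + c)
        rotate = solve-∀
apart-middle {x} {y} {z} (inj₂ y≺x) (inj₂ z≺y) _ refl _ _ x<T _ = ⊥-elim (<⇒≱ x<T (begin
  len x + len y + len z  ≡⟨ swap₁₃ (len x) (len y) (len z) ⟩
  len z + len y + len x  ≤⟨ +-monoˡ-≤ (len x) (≺-packing z≺y z≤n y≺x) ⟩
  end x                  ∎))
  where open ≤-Reasoning
        swap₁₃ : ∀ a b c → a + b + c ≡ c + b + a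
        swap₁₃ = solve-∀

mirror : ℕ → Interval → Interval
mirror T x = (T ∸ end x) ,+ len x

end-mirror : ∀ {T} x → end x ≤ T → end (mirror T x) ≡ T ∸ start x
end-mirror {T} x x≤T = begin
  T ∸ (start x + len x) + len x  ≡⟨ cong (_+ len x) (∸-+-assoc T (start x) (len x)) ⟨
  T ∸ start x ∸ len x + len x    ≡⟨ m∸n+n≡m len≤T∸start ⟩
  T ∸ start x                    ∎
  where
    open ≡-Reasoning
    len≤T∸start : len x ≤ T ∸ start x
    len≤T∸start = m+n≤o⇒m≤o∸n (len x) (subst (_≤ T) (+-comm (start x) (len x)) x≤T)

mirror-fits : ∀ {T x} → end x ≤ T → end (mirror T x) ≤ T
mirror-fits {T} {x} x≤T = subst (_≤ T) (sym (end-mirror x x≤T)) (m∸n≤m T (start x))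

mirror-apart : ∀ {T x y} → end x ≤ T → end y ≤ T → Apart x y → Apart (mirror T x) (mirror T y)
mirror-apart {T} {x} {y} _ y≤T (inj₁ x≺y) =
  inj₂ (subst (_≤ T ∸ end x) (sym (end-mirror y y≤T)) (∸-monoʳ-≤ T x≺y))
mirror-apart {T} {x} {y} x≤T _ (inj₂ y≺x) =
  inj₁ (subst (_≤ T ∸ end y) (sym (end-mirror x x≤T)) (∸-monoʳ-≤ T y≺x))

horizon-pred : ∀ {k} → 2 ≤ k → Σ ℕ λ K → k ≡ suc K × 1 ≤ K
horizon-pred (s≤s (s≤s {n = K} _)) = suc K , refl , s≤s z≤n

module _ {n} (I : PrecolInstance n) where
  open PrecolInstance I

  ptime-positive : 2 ≤ k → ∀ i → Present I i → 0 < ptime I i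
  ptime-positive _   (vtx _) _ = s≤s z≤n
  ptime-positive _   a       _ = s≤s z≤n
  ptime-positive _   b       _ = s≤s z≤n
  ptime-positive 2≤k a'      _ = m<n⇒0<n∸m 2≤k
  ptime-positive 2≤k b'      _ = m<n⇒0<n∸m 2≤k
  ptime-positive _   (j1 j)  c≢1 with pre j in eq
  ... | just c = m<n⇒0<n∸m (≤∧≢⇒< (proj₁ (pre-range j c eq)) (≢-sym c≢1))
  ptime-positive _   (j2 j)  c≢k with pre j in eq
  ... | just c = m<n⇒0<n∸m (≤∧≢⇒< (proj₂ (pre-range j c eq)) c≢k)

  record IntervalSchedule (T : ℕ) : Set where
    field
      startTime : Job n → ℕ
      fits      : ∀ i → Present I i → startTime i + ptime I i ≤ T
      apart     : ∀ i j → Present I i → Present I j → Conflict I i j →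
                  Apart (startTime i ,+ ptime I i) (startTime j ,+ ptime I j)

    run : Job n → Interval
    run i = startTime i ,+ ptime I i

  module _ {C : Job n → ℕ} (feasible : Feasible I C) (C≤k : CmaxLe I C k) where

    runOf : Job n → Interval
    runOf i = (C i ∸ ptime I i) ,+ ptime I i

    end-runOf : ∀ i → Present I i → end (runOf i) ≡ C i
    end-runOf i present = m∸n+n≡m (proj₁ feasible i present)

    runOf-fits : ∀ i → Present I i → end (runOf i) ≤ k
    runOf-fits i present = subst (_≤ k) (sym (end-runOf i present)) (C≤k i present)

    runOf-apart : ∀ i j → Present I i → Present I j → Conflict I i j →
      0 < ptime I i → 0 < ptime I j → Apart (runOf i) (runOf j)
    runOf-apart i j pᵢ pⱼ ij 0<pᵢ 0<pⱼ = disjoint⇒apart 0<pᵢ 0<pⱼ λ t (tᵢ , tⱼ) →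
      proj₂ feasible i j pᵢ pⱼ ij t (inRun i pᵢ tᵢ , inRun j pⱼ tⱼ)
      where
        inRun : ∀ i → Present I i → ∀ {t} → Occupies (runOf i) t → InRun I C i t
        inRun i present (s≤t , t<end) = s≤t , subst (_ <_) (end-runOf i present) t<end

    edge⇒2≤k : ∀ {u v} → Graph.Adj H u v → 2 ≤ k
    edge⇒2≤k {u} {v} uv =
      apart-packing (runOf-apart (vtx u) (vtx v) tt tt (inj₁ uv) (s≤s z≤n) (s≤s z≤n))
                    z≤n z≤n (runOf-fits (vtx u) tt) (runOf-fits (vtx v) tt)

    feasible⇒schedule : 2 ≤ k → IntervalSchedule k
    feasible⇒schedule 2≤k = record
      { startTime = λ i → start (runOf i)
      ; fits      = runOf-fits
      ; apart     = λ i j pᵢ pⱼ ij →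
          runOf-apart i j pᵢ pⱼ ij (ptime-positive 2≤k i pᵢ) (ptime-positive 2≤k j pⱼ)
      }

  reverse : ∀ {T} → IntervalSchedule T → IntervalSchedule T
  reverse {T} S = record
    { startTime = λ i → start (mirror T (run i))
    ; fits      = λ i present → mirror-fits {x = run i} (fits i present)
    ; apart     = λ i j pᵢ pⱼ ij → mirror-apart (fits i pᵢ) (fits j pⱼ) (apart i j pᵢ pⱼ ij)
    }
    where open IntervalSchedule S

  colour-split : ∀ {c} → 1 ≤ c → c ≤ k → c ∸ 1 + 1 + (k ∸ c) ≡ k
  colour-split {c} 1≤c c≤k = trans (cong (_+ (k ∸ c)) (m∸n+n≡m 1≤c)) (m+[n∸m]≡n c≤k)

  module Horizon {K : ℕ} (k≡1+K : k ≡ suc K) (1≤K : 1 ≤ K) where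

    1<k : 1 < k
    1<k = subst (1 <_) (sym k≡1+K) (s≤s 1≤K)

    positive : ∀ i → Present I i → 0 < ptime I i
    positive = ptime-positive 1<k

    module Normalised (S : IntervalSchedule (suc K))
                      (a-first : IntervalSchedule.startTime S a ≡ 0)
                      (b-last  : IntervalSchedule.startTime S b ≡ K) where
      open IntervalSchedule S

      after-a : ∀ i → Present I i → Conflict I a i → 1 ≤ startTime i
      after-a i present ai = subst (λ s → s + 1 ≤ startTime i) a-first
        (apart∧start≤⇒≺ (apart a i tt present ai) (subst (_≤ startTime i) (sym a-first) z≤n)
                        (positive i present))

      before-b : ∀ i → Present I i → Conflict I i b → end (run i) ≤ K
      before-b i present ib = subst (end (run i) ≤_) b-last
        (apart∧end≤⇒≺ (apart i b present tt ib) (subst (end (run i) ≤_) end-b (fits i present))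
                      (positive i present))
        where
          end-b : suc K ≡ startTime b + 1
          end-b = trans (+-comm 1 K) (cong (_+ 1) (sym b-last))

      module _ (v : Fin n) {c : ℕ} (pre≡c : pre v ≡ just c) where

        j1-present : c ≢ 1 → Present I (j1 v)
        j1-present = subst HasJ1 (sym pre≡c)

        j2-present : c ≢ k → Present I (j2 v)
        j2-present = subst (HasJ2 k) (sym pre≡c)

        first-colour : c ≡ 1 → suc (startTime (vtx v)) ≡ c
        first-colour c≡1 =
          [ (λ s≡0 → trans (cong suc s≡0) (sym c≡1))
          , (λ s≡K → ⊥-elim (m+1+n≰m K (subst (λ s → s + 1 ≤ K) (trans s≡K len≡K)
                                         (before-b (vtx v) tt (inj₂ present)))))
          ]′ (apart-tiling (apart (vtx v) (j2 v) tt present (inj₁ refl)) (cong suc len≡K)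
                           (fits (vtx v) tt) (fits (j2 v) present))
          where
            present : Present I (j2 v)
            present = j2-present λ c≡k → <-irrefl (trans (sym c≡1) c≡k) 1<k
            len≡K : ptime I (j2 v) ≡ K
            len≡K = trans (cong (p2 k) pre≡c) (cong₂ _∸_ k≡1+K c≡1)

        last-colour : c ≢ 1 → c ≡ k → suc (startTime (vtx v)) ≡ c
        last-colour c≢1 c≡k =
          [ (λ s≡0 → ⊥-elim (<⇒≢ (after-a (vtx v) tt (inj₁ present)) (sym s≡0)))
          , (λ s≡K → trans (cong suc (trans s≡K len≡K)) (sym c≡1+K))
          ]′ (apart-tiling (apart (vtx v) (j1 v) tt present (inj₁ refl)) (cong suc len≡K)
                           (fits (vtx v) tt) (fits (j1 v) present))
          where
            present : Present I (j1 v)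
            present = j1-present c≢1
            c≡1+K : c ≡ suc K
            c≡1+K = trans c≡k k≡1+K
            len≡K : ptime I (j1 v) ≡ K
            len≡K = trans (cong p1 pre≡c) (cong (_∸ 1) c≡1+K)

        inner-colour : c ≢ 1 → c ≢ k → suc (startTime (vtx v)) ≡ c
        inner-colour c≢1 c≢k = begin
          suc (startTime (vtx v))  ≡⟨ cong suc (trans s≡len (cong p1 pre≡c)) ⟩
          suc (c ∸ 1)              ≡⟨ m+[n∸m]≡n 1≤c ⟩
          c                        ∎
          where
            open ≡-Reasoning
            1≤c : 1 ≤ c
            1≤c = proj₁ (pre-range v c pre≡c)
            c≤k : c ≤ k
            c≤k = proj₂ (pre-range v c pre≡c)
            present₁ : Present I (j1 v)
            present₁ = j1-present c≢1
            present₂ : Present I (j2 v)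
            present₂ = j2-present c≢k
            lengths : ptime I (j1 v) + 1 + ptime I (j2 v) ≡ suc K
            lengths = trans (cong (λ m → p1 m + 1 + p2 k m) pre≡c)
                            (trans (colour-split 1≤c c≤k) k≡1+K)
            s≡len : startTime (vtx v) ≡ ptime I (j1 v)
            s≡len = apart-middle
              (apart (j1 v) (vtx v) present₁ tt (inj₂ refl))
              (apart (vtx v) (j2 v) tt present₂ (inj₁ refl))
              (apart (j1 v) (j2 v) present₁ present₂ (inj₁ refl))
              lengths
              (after-a (vtx v) tt (inj₁ present₁))
              (s≤s (before-b (vtx v) tt (inj₂ present₂)))
              (s≤s (before-b (j1 v) present₁ (inj₂ tt)))
              (fits (j2 v) present₂)

      precoloured : ∀ v c → pre v ≡ just c → suc (startTime (vtx v)) ≡ c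
      precoloured v c pre≡c with c ≟ 1 | c ≟ k
      ... | yes c≡1 | _       = first-colour v pre≡c c≡1
      ... | no c≢1  | yes c≡k = last-colour v pre≡c c≢1 c≡k
      ... | no c≢1  | no c≢k  = inner-colour v pre≡c c≢1 c≢k

      solution : Σ (Fin n → ℕ) (IsSolution I)
      solution = colour , in-range , proper , precoloured
        where
          colour : Fin n → ℕ
          colour v = suc (startTime (vtx v))
          in-range : ∀ v → 1 ≤ colour v × colour v ≤ k
          in-range v =
            s≤s z≤n , subst₂ _≤_ (+-comm (startTime (vtx v)) 1) (sym k≡1+K) (fits (vtx v) tt)
          proper : ∀ u v → Graph.Adj H u v → colour u ≢ colour v
          proper u v uv = apart⇒start≢ (apart (vtx u) (vtx v) tt tt (inj₁ uv)) (s≤s z≤n) (s≤s z≤n)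
                          ∘ suc-injective

    module _ (S : IntervalSchedule (suc K)) where
      open IntervalSchedule S

      beside-block : ∀ e e' → Conflict I e e' → ptime I e ≡ 1 → ptime I e' ≡ K →
        Present I e → Present I e' → startTime e ≡ 0 ⊎ startTime e ≡ K
      beside-block e e' ee' len≡1 len'≡K pₑ pₑ' =
        map₂ (λ s≡len' → trans s≡len' len'≡K)
          (apart-tiling (apart e e' pₑ pₑ' ee') (cong₂ _+_ len≡1 len'≡K) (fits e pₑ) (fits e' pₑ'))

      a≢b : startTime a ≢ startTime b
      a≢b = apart⇒start≢ (apart a b tt tt (inj₁ tt)) (s≤s z≤n) (s≤s z≤n)

      a-b-positions : (startTime a ≡ 0 × startTime b ≡ K) ⊎ (startTime a ≡ K × startTime b ≡ 0)
      a-b-positions with beside-block a a' (inj₁ tt) refl (cong (_∸ 1) k≡1+K) tt tt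
                       | beside-block b b' (inj₁ tt) refl (cong (_∸ 1) k≡1+K) tt tt
      ... | inj₁ a≡0 | inj₂ b≡K = inj₁ (a≡0 , b≡K)
      ... | inj₂ a≡K | inj₁ b≡0 = inj₂ (a≡K , b≡0)
      ... | inj₁ a≡0 | inj₁ b≡0 = ⊥-elim (a≢b (trans a≡0 (sym b≡0)))
      ... | inj₂ a≡K | inj₂ b≡K = ⊥-elim (a≢b (trans a≡K (sym b≡K)))

      solution : Σ (Fin n → ℕ) (IsSolution I)
      solution with a-b-positions
      ... | inj₁ (a≡0 , b≡K) = Normalised.solution S a≡0 b≡K
      ... | inj₂ (a≡K , b≡0) =
        Normalised.solution (reverse S) (reflect-last a≡K) (reflect-first b≡0)
        where
          reflect-last : ∀ {s} → s ≡ K → suc K ∸ (s + 1) ≡ 0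
          reflect-last refl = trans (cong (suc K ∸_) (+-comm K 1)) (n∸n≡0 (suc K))
          reflect-first : ∀ {s} → s ≡ 0 → suc K ∸ (s + 1) ≡ K
          reflect-first refl = refl

  schedule⇒solution : 2 ≤ k → IntervalSchedule k → Σ (Fin n → ℕ) (IsSolution I)
  schedule⇒solution 2≤k S with horizon-pred 2≤k
  ... | K , k≡1+K , 1≤K = Horizon.solution k≡1+K 1≤K (subst IntervalSchedule k≡1+K S)

lemma10 : (n : ℕ) (I : PrecolInstance n) →
    Σ (Fin n) (λ u → Σ (Fin n) (λ v → Graph.Adj (PrecolInstance.H I) u v)) →
    (C : Job n → ℕ) → Feasible I C → CmaxLe I C (PrecolInstance.k I) →
    Σ (Fin n → ℕ) (λ χ' → IsSolution I χ')
lemma10 n I (u , v , uv) C feasible C≤k =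
  schedule⇒solution I 2≤k (feasible⇒schedule I feasible C≤k 2≤k)
  where
    2≤k : 2 ≤ PrecolInstance.k I
    2≤k = edge⇒2≤k I feasible C≤k uv
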